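{- Let $A$ be a symmetric integer matrix such that $$A\pmod 4=\mathrm{diag}\Big(r\begin{pmatrix}2&1\\1&2\end{pmatrix}, s\begin{pmatrix}0&1\\1&0\end{pmatrix}, t\begin{pmatrix}0&2\\2&0\end{pmatrix}, p(2), m(0)\Big)$$ for non-negative integers $p,s,t,m$ and $r\ge2$. Then there is an integer matrix $P$ with $\det(P)=\pm1$ such that $$P^TAP\pmod 4=\mathrm{diag}\Big((r-2)\begin{pmatrix}2&1\\1&2\end{pmatrix}, (s+2)\begin{pmatrix}0&1\\1&0\end{pmatrix}, t\begin{pmatrix}0&2\\2&0\end{pmatrix}, p(2), m(0)\Big).$$ In particular, $A$ has a normal form in which the parameter $r$ is $0$ or $1$.
   Context: "$M\pmod 4$" is entrywise reduction into $\{0,1,2,3\}$; $\mathrm{diag}(\dots)$ with multiplicities denotes the block diagonal matrix with the indicated numbers of copies of each block. A normal form of a symmetric integer matrix $A$ with even diagonal is a matrix $\mathrm{diag}\big(r\begin{pmatrix}2&1\\1&2\end{pmatrix}, s\begin{pmatrix}0&1\\1&0\end{pmatrix}, t\begin{pmatrix}0&2\\2&0\end{pmatrix}, p(2), m(0)\big)$ equal to $P^TAP\pmod 4$ for some integer $P$ with $\det P=\pm1$. -}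

module Defs where

open import Data.Nat as ℕ using (ℕ; zero; suc; _∸_; _<ᵇ_)
open import Data.Bool using (Bool; true; false; if_then_else_; _∧_)
open import Data.Integer as ℤ using (ℤ; _%ℕ_)
open import Data.Fin using (Fin; toℕ; punchIn) renaming (zero to fzero; suc to fsuc)
open import Data.List using (List; []; _∷_; _++_; replicate)

Mat : ℕ → Set → Set
Mat n A = Fin n → Fin n → A

transpose : ∀ {n} {A : Set} → Mat n A → Mat n A
transpose M i j = M j i

sumFin : ∀ {n} → (Fin n → ℤ) → ℤ
sumFin {zero} f = ℤ.0ℤ
sumFin {suc n} f = f fzero ℤ.+ sumFin (λ i → f (fsuc i))

_·_ : ∀ {n} → Mat n ℤ → Mat n ℤ → Mat n ℤ
(M · N) i k = sumFin (λ j → M i j ℤ.* N j k)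

sign : ℕ → ℤ
sign zero = ℤ.1ℤ
sign (suc k) = ℤ.- sign k

det : ∀ {n} → Mat n ℤ → ℤ
det {zero} M = ℤ.1ℤ
det {suc n} M =
  sumFin (λ j → sign (toℕ j) ℤ.* (M fzero j ℤ.* det (λ i k → M (fsuc i) (punchIn j k))))

mod4 : ∀ {n} → Mat n ℤ → Mat n ℕ
mod4 M i j = M i j %ℕ 4

data Block : Set where
  H : Block
  U : Block
  V : Block
  D2 : Block
  D0 : Block

bsize : Block → ℕ
bsize H = 2
bsize U = 2
bsize V = 2
bsize D2 = 1
bsize D0 = 1

-- entries of a block (indices assumed < bsize)
bentry : Block → ℕ → ℕ → ℕ
bentry H zero zero = 2
bentry H (suc _) (suc _) = 2
bentry H _ _ = 1
bentry U zero zero = 0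
bentry U (suc _) (suc _) = 0
bentry U _ _ = 1
bentry V zero zero = 0
bentry V (suc _) (suc _) = 0
bentry V _ _ = 2
bentry D2 _ _ = 2
bentry D0 _ _ = 0

totalSize : List Block → ℕ
totalSize [] = 0
totalSize (b ∷ bs) = bsize b ℕ.+ totalSize bs

bdEntry : List Block → ℕ → ℕ → ℕ
bdEntry [] i j = 0
bdEntry (b ∷ bs) i j =
  if (i <ᵇ bsize b) ∧ (j <ᵇ bsize b) then bentry b i j
  else if (i <ᵇ bsize b) then 0
  else if (j <ᵇ bsize b) then 0
  else bdEntry bs (i ∸ bsize b) (j ∸ bsize b)

-- block diagonal matrix as an n × n matrix (meaningful when totalSize bs ≡ n)
blockDiag : (n : ℕ) → List Block → Mat n ℕ
blockDiag n bs i j = bdEntry bs (toℕ i) (toℕ j)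

nfBlocks : ℕ → ℕ → ℕ → ℕ → ℕ → List Block
nfBlocks r s t p m =
  replicate r H ++ replicate s U ++ replicate t V ++ replicate p D2 ++ replicate m D0

Unimodular : ∀ {n} → Mat n ℤ → Set
Unimodular P = (det P ≡ ℤ.1ℤ) ⊎ (det P ≡ ℤ.-1ℤ)
  where
  open import Relation.Binary.PropositionalEquality using (_≡_)
  open import Data.Sum using (_⊎_)

Symmetric : ∀ {n} → Mat n ℤ → Set
Symmetric M = ∀ i j → M i j ≡ M j i
  where open import Relation.Binary.PropositionalEquality using (_≡_)

{-# OPTIONS --safe #-}
-- Modulo 4 the form H ⊕ H, with H = (2 1; 1 2), is congruent to U ⊕ U by a basis of determinant 1:
-- the columns of hyperbolicBasis are two orthogonal hyperbolic pairs of H ⊕ H modulo 4. Such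
-- congruences are compatible with block-diagonal sums, so inside the normal form any pair of
-- H-blocks can be traded for a pair of U-blocks while every other block keeps the identity basis.
-- Trading one pair gives the first claim; trading ⌊(2 + r)/2⌋ pairs leaves (2 + r) mod 2 ≤ 1 H-blocks.
module Submission where

open import Data.Bool using (true; false; if_then_else_; _∨_)
open import Data.Bool.Properties using (T-≡)
open import Data.Fin using (Fin; toℕ; punchIn) renaming (zero to fzero; suc to fsuc)
open import Data.Fin.Properties using (toℕ<n)
open import Data.Integer as ℤ using (ℤ; +_; 0ℤ; 1ℤ; -1ℤ; _%ℕ_; _/ℕ_; ∣_∣; _⊖_)
open import Data.Integer.DivMod using (a≡a%ℕn+[a/ℕn]*n; n%ℕd<d)
import Data.Integer.Properties as ℤ
open import Data.Integer.Tactic.RingSolver using (solve-∀)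
open import Data.List using (List; []; _∷_; _++_; replicate; head; drop)
import Data.List.Properties as List
open import Data.Maybe using (fromMaybe)
open import Data.Nat as ℕ using (ℕ; zero; suc; _<_; _<ᵇ_; _∸_; z≤n; s≤s; z<s; s<s)
import Data.Nat.Properties as ℕ
open import Data.Nat.DivMod using (m<n⇒m%n≡m; m%n<n; m≡m%n+[m/n]*n)
open import Data.Nat.Divisibility using (divides; n∣m⇒m%n≡0)
open import Data.Product using (Σ; _×_; _,_)
open import Data.Sum using (inj₁)
open import Function.Bundles using (Equivalence)
open import Relation.Binary.PropositionalEquality
open import Relation.Nullary.Decidable using (from-yes)

open import Defs

infix 4 _≡_mod_

record _≡_mod_ (x y : ℤ) (d : ℕ) : Set where
  constructor multiple
  field
    quotient : ℤ
    difference : x ≡ y ℤ.+ quotient ℤ.* + d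

module Residue {d : ℕ} .{{_ : ℕ.NonZero d}} where

  open import Data.Integer using (_+_; _-_; _*_)

  -- Two remainders of x differ by a multiple of d of absolute value below d.
  %ℕ-unique : ∀ {x r} q → r < d → x ≡ + r + q * + d → x %ℕ d ≡ r
  %ℕ-unique {x} {r} q r<d x≡r+qd = ℤ.+-injective (ℤ.i-j≡0⇒i≡j _ _ (begin
      + r′ - + r  ≡⟨ ℤ.[+m]-[+n]≡m⊖n r′ r ⟩
      r′ ⊖ r      ≡⟨ ℤ.∣i∣≡0⇒i≡0 ∣r′⊖r∣≡0 ⟩
      + 0         ∎))
    where
    open ≡-Reasoning
    r′ = x %ℕ d
    q′ = x /ℕ d
    shift : ∀ a b u v D → a - b ≡ (a + u * D) - (b + v * D) + (v - u) * D
    shift = solve-∀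
    r′-r≡[q-q′]d : + r′ - + r ≡ (q - q′) * + d
    r′-r≡[q-q′]d = begin
      + r′ - + r
        ≡⟨ shift (+ r′) (+ r) q′ q (+ d) ⟩
      (+ r′ + q′ * + d) - (+ r + q * + d) + (q - q′) * + d
        ≡⟨ cong (λ z → z - (+ r + q * + d) + (q - q′) * + d)
                (trans (sym (a≡a%ℕn+[a/ℕn]*n x d)) x≡r+qd) ⟩
      (+ r + q * + d) - (+ r + q * + d) + (q - q′) * + d
        ≡⟨ cong (_+ (q - q′) * + d) (ℤ.+-inverseʳ (+ r + q * + d)) ⟩
      + 0 + (q - q′) * + d
        ≡⟨ ℤ.+-identityˡ _ ⟩
      (q - q′) * + d
        ∎
    ∣r′⊖r∣≡0 : ∣ r′ ⊖ r ∣ ≡ 0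
    ∣r′⊖r∣≡0 = trans (sym (m<n⇒m%n≡m ∣r′⊖r∣<d)) (n∣m⇒m%n≡0 _ d d∣∣r′⊖r∣)
      where
      ∣r′⊖r∣<d = ℕ.≤-<-trans (ℤ.∣m⊝n∣≤m⊔n r′ r) (ℕ.⊔-pres-<m (n%ℕd<d x d) r<d)
      d∣∣r′⊖r∣ = divides ∣ q - q′ ∣ (begin
        ∣ r′ ⊖ r ∣          ≡⟨ cong ∣_∣ (trans (sym (ℤ.[+m]-[+n]≡m⊖n r′ r)) r′-r≡[q-q′]d) ⟩
        ∣ (q - q′) * + d ∣  ≡⟨ ℤ.abs-* (q - q′) (+ d) ⟩
        ∣ q - q′ ∣ ℕ.* d    ∎)

  mod-refl : ∀ {x} → x ≡ x mod d
  mod-refl {x} = multiple 0ℤ (sym (ℤ.+-identityʳ x))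

  mod-+-cong : ∀ {x y x′ y′} → x ≡ y mod d → x′ ≡ y′ mod d → x + x′ ≡ y + y′ mod d
  mod-+-cong {y = y} {y′ = y′} (multiple k refl) (multiple k′ refl) =
    multiple (k + k′) (regroup y y′ k k′ (+ d))
    where
    regroup : ∀ y y′ k k′ D → (y + k * D) + (y′ + k′ * D) ≡ (y + y′) + (k + k′) * D
    regroup = solve-∀

  mod-*-cong : ∀ {x y x′ y′} → x ≡ y mod d → x′ ≡ y′ mod d → x * x′ ≡ y * y′ mod d
  mod-*-cong {y = y} {y′ = y′} (multiple k refl) (multiple k′ refl) =
    multiple (k * y′ + y * k′ + k * k′ * + d) (expand y y′ k k′ (+ d))
    where
    expand : ∀ y y′ k k′ D →
             (y + k * D) * (y′ + k′ * D) ≡ y * y′ + (k * y′ + y * k′ + k * k′ * D) * D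
    expand = solve-∀

  x≡x%ℕd-mod : ∀ x → x ≡ + (x %ℕ d) mod d
  x≡x%ℕd-mod x = multiple (x /ℕ d) (a≡a%ℕn+[a/ℕn]*n x d)

  mod⇒%ℕ≡ : ∀ {x y} → x ≡ y mod d → x %ℕ d ≡ y %ℕ d
  mod⇒%ℕ≡ {y = y} (multiple k refl) = %ℕ-unique (y /ℕ d + k) (n%ℕd<d y d) (begin
    y + k * + d                                  ≡⟨ cong (_+ k * + d) (a≡a%ℕn+[a/ℕn]*n y d) ⟩
    (+ (y %ℕ d) + (y /ℕ d) * + d) + k * + d      ≡⟨ regroup (+ (y %ℕ d)) (y /ℕ d) k (+ d) ⟩
    + (y %ℕ d) + (y /ℕ d + k) * + d              ∎)
    where
    open ≡-Reasoning
    regroup : ∀ r q k D → (r + q * D) + k * D ≡ r + (q + k) * D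
    regroup = solve-∀

  mod-sumFin-cong : ∀ {n} {f g : Fin n → ℤ} → (∀ i → f i ≡ g i mod d) → sumFin f ≡ sumFin g mod d
  mod-sumFin-cong {zero}  f≡g = mod-refl
  mod-sumFin-cong {suc n} f≡g = mod-+-cong (f≡g fzero) (mod-sumFin-cong (λ i → f≡g (fsuc i)))

open Residue

module Matrix where

  open import Data.Integer using (_+_; _*_)
  open ≡-Reasoning

  -- Matrices indexed by all of ℕ: sumᴺ, mulᴺ and detᴺ read only the entries below their size
  -- argument, and M : Mat n ℤ is represented by any X with M i j ≡ X (toℕ i) (toℕ j).
  Matᴺ : Set
  Matᴺ = ℕ → ℕ → ℤ

  sumᴺ : ℕ → (ℕ → ℤ) → ℤ
  sumᴺ zero    f = 0ℤ
  sumᴺ (suc n) f = f 0 + sumᴺ n (λ k → f (suc k))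

  mulᴺ : ℕ → Matᴺ → Matᴺ → Matᴺ
  mulᴺ n X Y i j = sumᴺ n (λ k → X i k * Y k j)

  transposeᴺ : Matᴺ → Matᴺ
  transposeᴺ X i j = X j i

  punchInᴺ : ℕ → ℕ → ℕ
  punchInᴺ zero    k       = suc k
  punchInᴺ (suc j) zero    = zero
  punchInᴺ (suc j) (suc k) = suc (punchInᴺ j k)

  minorᴺ : ℕ → Matᴺ → Matᴺ
  minorᴺ j X i k = X (suc i) (punchInᴺ j k)

  detᴺ : ℕ → Matᴺ → ℤ
  detᴺ zero    X = 1ℤ
  detᴺ (suc n) X = sumᴺ (suc n) (λ j → sign j * (X 0 j * detᴺ n (minorᴺ j X)))

  idᴺ : Matᴺ
  idᴺ zero    zero    = 1ℤ
  idᴺ zero    (suc _) = 0ℤ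
  idᴺ (suc _) zero    = 0ℤ
  idᴺ (suc i) (suc j) = idᴺ i j

  _⊕[_]_ : Matᴺ → ℕ → Matᴺ → Matᴺ
  (X ⊕[ a ] Y) i j =
    if i <ᵇ a then (if j <ᵇ a then X i j else 0ℤ)
    else (if j <ᵇ a then 0ℤ else Y (i ∸ a) (j ∸ a))

  x≡0⇒x*y≡0 : ∀ {x} y → x ≡ 0ℤ → x * y ≡ 0ℤ
  x≡0⇒x*y≡0 y refl = refl

  y≡0⇒x*y≡0 : ∀ x {y} → y ≡ 0ℤ → x * y ≡ 0ℤ
  y≡0⇒x*y≡0 x refl = ℤ.*-zeroʳ x

  sumᴺ-cong : ∀ n {f g : ℕ → ℤ} → (∀ {k} → k < n → f k ≡ g k) → sumᴺ n f ≡ sumᴺ n g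
  sumᴺ-cong zero    f≡g = refl
  sumᴺ-cong (suc n) f≡g = cong₂ _+_ (f≡g z<s) (sumᴺ-cong n (λ k<n → f≡g (s<s k<n)))

  sumᴺ-zero : ∀ n {f : ℕ → ℤ} → (∀ {k} → k < n → f k ≡ 0ℤ) → sumᴺ n f ≡ 0ℤ
  sumᴺ-zero zero    f≡0 = refl
  sumᴺ-zero (suc n) f≡0 = cong₂ _+_ (f≡0 z<s) (sumᴺ-zero n (λ k<n → f≡0 (s<s k<n)))

  sumᴺ-split : ∀ a b (f : ℕ → ℤ) → sumᴺ (a ℕ.+ b) f ≡ sumᴺ a f + sumᴺ b (λ k → f (a ℕ.+ k))
  sumᴺ-split zero    b f = sym (ℤ.+-identityˡ _)
  sumᴺ-split (suc a) b f =
    trans (cong (_+_ (f 0)) (sumᴺ-split a b (λ k → f (suc k)))) (sym (ℤ.+-assoc (f 0) _ _))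

  sumᴺ-*ʳ : ∀ n (f : ℕ → ℤ) c → sumᴺ n (λ k → f k * c) ≡ sumᴺ n f * c
  sumᴺ-*ʳ zero    f c = refl
  sumᴺ-*ʳ (suc n) f c =
    trans (cong (_+_ (f 0 * c)) (sumᴺ-*ʳ n (λ k → f (suc k)) c)) (sym (ℤ.*-distribʳ-+ c (f 0) _))

  mulᴺ-cong : ∀ n {X X′ Y Y′ : Matᴺ} → (∀ i j → X i j ≡ X′ i j) → (∀ i j → Y i j ≡ Y′ i j) →
              ∀ i j → mulᴺ n X Y i j ≡ mulᴺ n X′ Y′ i j
  mulᴺ-cong n X≗X′ Y≗Y′ i j = sumᴺ-cong n (λ {k} _ → cong₂ _*_ (X≗X′ i k) (Y≗Y′ k j))

  detᴺ-cong : ∀ n {X X′ : Matᴺ} → (∀ i j → X i j ≡ X′ i j) → detᴺ n X ≡ detᴺ n X′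
  detᴺ-cong zero    X≗X′ = refl
  detᴺ-cong (suc n) X≗X′ = sumᴺ-cong (suc n) (λ {j} _ →
    cong₂ (λ x y → sign j * (x * y)) (X≗X′ 0 j)
          (detᴺ-cong n (λ i k → X≗X′ (suc i) (punchInᴺ j k))))

  transposeᴺ-idᴺ : ∀ i j → transposeᴺ idᴺ i j ≡ idᴺ i j
  transposeᴺ-idᴺ zero    zero    = refl
  transposeᴺ-idᴺ zero    (suc j) = refl
  transposeᴺ-idᴺ (suc i) zero    = refl
  transposeᴺ-idᴺ (suc i) (suc j) = transposeᴺ-idᴺ i j

  mulᴺ-identityˡ : ∀ n X {i j} → i < n → mulᴺ n idᴺ X i j ≡ X i j
  mulᴺ-identityˡ (suc n) X {zero} {j} _ = begin
    1ℤ * X 0 j + sumᴺ n (λ k → 0ℤ * X (suc k) j)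
      ≡⟨ cong₂ _+_ (ℤ.*-identityˡ (X 0 j)) (sumᴺ-zero n (λ _ → refl)) ⟩
    X 0 j + 0ℤ
      ≡⟨ ℤ.+-identityʳ (X 0 j) ⟩
    X 0 j
      ∎
  mulᴺ-identityˡ (suc n) X {suc i} {j} (s<s i<n) = begin
    0ℤ * X 0 j + mulᴺ n idᴺ (λ k → X (suc k)) i j
      ≡⟨ ℤ.+-identityˡ (mulᴺ n idᴺ (λ k → X (suc k)) i j) ⟩
    mulᴺ n idᴺ (λ k → X (suc k)) i j
      ≡⟨ mulᴺ-identityˡ n (λ k → X (suc k)) i<n ⟩
    X (suc i) j
      ∎

  mulᴺ-identityʳ : ∀ n X {i j} → j < n → mulᴺ n X idᴺ i j ≡ X i j
  mulᴺ-identityʳ (suc n) X {i} {zero} _ = begin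
    X i 0 * 1ℤ + sumᴺ n (λ k → X i (suc k) * 0ℤ)
      ≡⟨ cong₂ _+_ (ℤ.*-identityʳ (X i 0)) (sumᴺ-zero n (λ {k} _ → ℤ.*-zeroʳ (X i (suc k)))) ⟩
    X i 0 + 0ℤ
      ≡⟨ ℤ.+-identityʳ (X i 0) ⟩
    X i 0
      ∎
  mulᴺ-identityʳ (suc n) X {i} {suc j} (s<s j<n) = begin
    X i 0 * 0ℤ + mulᴺ n X′ idᴺ i j
      ≡⟨ cong (_+ mulᴺ n X′ idᴺ i j) (ℤ.*-zeroʳ (X i 0)) ⟩
    0ℤ + mulᴺ n X′ idᴺ i j
      ≡⟨ ℤ.+-identityˡ (mulᴺ n X′ idᴺ i j) ⟩
    mulᴺ n X′ idᴺ i j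
      ≡⟨ mulᴺ-identityʳ n X′ j<n ⟩
    X i (suc j)
      ∎
    where
    X′ : Matᴺ
    X′ i k = X i (suc k)

  detᴺ-idᴺ : ∀ n → detᴺ n idᴺ ≡ 1ℤ
  detᴺ-idᴺ zero    = refl
  detᴺ-idᴺ (suc n) = begin
    1ℤ * (1ℤ * detᴺ n idᴺ) + sumᴺ n (λ j → sign (suc j) * (0ℤ * detᴺ n (minorᴺ (suc j) idᴺ)))
      ≡⟨ cong₂ _+_ (trans (ℤ.*-identityˡ _) (ℤ.*-identityˡ (detᴺ n idᴺ)))
                   (sumᴺ-zero n (λ {j} _ → ℤ.*-zeroʳ (sign (suc j)))) ⟩
    detᴺ n idᴺ + 0ℤ
      ≡⟨ ℤ.+-identityʳ (detᴺ n idᴺ) ⟩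
    detᴺ n idᴺ
      ≡⟨ detᴺ-idᴺ n ⟩
    1ℤ ∎

  <⇒<ᵇ≡true : ∀ {i a} → i < a → (i <ᵇ a) ≡ true
  <⇒<ᵇ≡true i<a = Equivalence.to T-≡ (ℕ.<⇒<ᵇ i<a)

  +-<ᵇ≡false : ∀ a i → (a ℕ.+ i <ᵇ a) ≡ false
  +-<ᵇ≡false zero    i = refl
  +-<ᵇ≡false (suc a) i = +-<ᵇ≡false a i

  data Position (a : ℕ) : ℕ → Set where
    inside : ∀ {i} → i < a → Position a i
    beyond : ∀ i → Position a (a ℕ.+ i)

  position : ∀ a i → Position a i
  position zero    i       = beyond i
  position (suc a) zero    = inside z<s
  position (suc a) (suc i) with position a i
  ... | inside i<a = inside (s<s i<a)
  ... | beyond i′  = beyond i′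

  module _ (X : Matᴺ) (a : ℕ) (Y : Matᴺ) where

    ⊕-topLeft : ∀ {i j} → i < a → j < a → (X ⊕[ a ] Y) i j ≡ X i j
    ⊕-topLeft i<a j<a rewrite <⇒<ᵇ≡true i<a | <⇒<ᵇ≡true j<a = refl

    ⊕-topRight : ∀ {i} j → i < a → (X ⊕[ a ] Y) i (a ℕ.+ j) ≡ 0ℤ
    ⊕-topRight j i<a rewrite <⇒<ᵇ≡true i<a | +-<ᵇ≡false a j = refl

    ⊕-bottomLeft : ∀ i {j} → j < a → (X ⊕[ a ] Y) (a ℕ.+ i) j ≡ 0ℤ
    ⊕-bottomLeft i j<a rewrite +-<ᵇ≡false a i | <⇒<ᵇ≡true j<a = refl

    ⊕-bottomRight : ∀ i j → (X ⊕[ a ] Y) (a ℕ.+ i) (a ℕ.+ j) ≡ Y i j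
    ⊕-bottomRight i j rewrite +-<ᵇ≡false a i | +-<ᵇ≡false a j
                            | ℕ.m+n∸m≡n a i | ℕ.m+n∸m≡n a j = refl

  ⊕-congˡ : ∀ a {X X′} Y → (∀ i j → X i j ≡ X′ i j) →
            ∀ i j → (X ⊕[ a ] Y) i j ≡ (X′ ⊕[ a ] Y) i j
  ⊕-congˡ a Y X≗X′ i j with i <ᵇ a | j <ᵇ a
  ... | true  | true  = X≗X′ i j
  ... | true  | false = refl
  ... | false | true  = refl
  ... | false | false = refl

  ⊕-congʳ : ∀ a X {Y Y′} → (∀ i j → Y i j ≡ Y′ i j) →
            ∀ i j → (X ⊕[ a ] Y) i j ≡ (X ⊕[ a ] Y′) i j
  ⊕-congʳ a X Y≗Y′ i j with i <ᵇ a | j <ᵇ a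
  ... | true  | true  = refl
  ... | true  | false = refl
  ... | false | true  = refl
  ... | false | false = Y≗Y′ (i ∸ a) (j ∸ a)

  transposeᴺ-⊕ : ∀ a X Y i j →
                 transposeᴺ (X ⊕[ a ] Y) i j ≡ (transposeᴺ X ⊕[ a ] transposeᴺ Y) i j
  transposeᴺ-⊕ a X Y i j with i <ᵇ a | j <ᵇ a
  ... | true  | true  = refl
  ... | true  | false = refl
  ... | false | true  = refl
  ... | false | false = refl

  <ᵇ-+ : ∀ i a b → (i <ᵇ a ℕ.+ b) ≡ (i <ᵇ a) ∨ (i ∸ a <ᵇ b)
  <ᵇ-+ i       zero    b = refl
  <ᵇ-+ zero    (suc a) b = refl
  <ᵇ-+ (suc i) (suc a) b = <ᵇ-+ i a b

  ⊕-assoc : ∀ a b X Y Z i j →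
            (X ⊕[ a ] (Y ⊕[ b ] Z)) i j ≡ ((X ⊕[ a ] Y) ⊕[ a ℕ.+ b ] Z) i j
  ⊕-assoc a b X Y Z i j
    rewrite <ᵇ-+ i a b | <ᵇ-+ j a b | ℕ.∸-+-assoc i a b | ℕ.∸-+-assoc j a b
    with i <ᵇ a | j <ᵇ a | i ∸ a <ᵇ b | j ∸ a <ᵇ b
  ... | true  | true  | _     | _     = refl
  ... | true  | false | _     | true  = refl
  ... | true  | false | _     | false = refl
  ... | false | true  | true  | _     = refl
  ... | false | true  | false | _     = refl
  ... | false | false | true  | true  = refl
  ... | false | false | true  | false = refl
  ... | false | false | false | true  = refl
  ... | false | false | false | false = refl

  ⊕-pointwise : ∀ (R : ℤ → ℤ → Set) → R 0ℤ 0ℤ → ∀ {a b} {X X′ Y Y′ : Matᴺ} →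
    (∀ {i j} → i < a → j < a → R (X i j) (X′ i j)) →
    (∀ {i j} → i < b → j < b → R (Y i j) (Y′ i j)) →
    ∀ {i j} → i < a ℕ.+ b → j < a ℕ.+ b → R ((X ⊕[ a ] Y) i j) ((X′ ⊕[ a ] Y′) i j)
  ⊕-pointwise R R00 {a} {X = X} {X′} {Y} {Y′} RX RY {i} {j} i<a+b j<a+b
    with position a i | position a j
  ... | inside i<a | inside j<a =
    subst₂ R (sym (⊕-topLeft X a Y i<a j<a)) (sym (⊕-topLeft X′ a Y′ i<a j<a)) (RX i<a j<a)
  ... | inside i<a | beyond j =
    subst₂ R (sym (⊕-topRight X a Y j i<a)) (sym (⊕-topRight X′ a Y′ j i<a)) R00
  ... | beyond i | inside j<a =
    subst₂ R (sym (⊕-bottomLeft X a Y i j<a)) (sym (⊕-bottomLeft X′ a Y′ i j<a)) R00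
  ... | beyond i | beyond j =
    subst₂ R (sym (⊕-bottomRight X a Y i j)) (sym (⊕-bottomRight X′ a Y′ i j))
             (RY (ℕ.+-cancelˡ-< a _ _ i<a+b) (ℕ.+-cancelˡ-< a _ _ j<a+b))

  mulᴺ-⊕ : ∀ a b X Y X′ Y′ i j →
    mulᴺ (a ℕ.+ b) (X ⊕[ a ] Y) (X′ ⊕[ a ] Y′) i j ≡ (mulᴺ a X X′ ⊕[ a ] mulᴺ b Y Y′) i j
  mulᴺ-⊕ a b X Y X′ Y′ i j = trans (sumᴺ-split a b _) (split (position a i) (position a j))
    where
    L = X ⊕[ a ] Y
    R = X′ ⊕[ a ] Y′
    split : ∀ {i j} → Position a i → Position a j →
      sumᴺ a (λ k → L i k * R k j) + sumᴺ b (λ k → L i (a ℕ.+ k) * R (a ℕ.+ k) j)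
        ≡ (mulᴺ a X X′ ⊕[ a ] mulᴺ b Y Y′) i j
    split (inside i<a) (inside j<a) = begin
      sumᴺ a _ + sumᴺ b _
        ≡⟨ cong₂ _+_ (sumᴺ-cong a (λ k<a →
                       cong₂ _*_ (⊕-topLeft X a Y i<a k<a) (⊕-topLeft X′ a Y′ k<a j<a)))
                     (sumᴺ-zero b (λ {k} _ → x≡0⇒x*y≡0 _ (⊕-topRight X a Y k i<a))) ⟩
      mulᴺ a X X′ _ _ + 0ℤ  ≡⟨ ℤ.+-identityʳ _ ⟩
      mulᴺ a X X′ _ _       ≡⟨ sym (⊕-topLeft (mulᴺ a X X′) a (mulᴺ b Y Y′) i<a j<a) ⟩
      _                     ∎
    split {i} (inside i<a) (beyond j) = begin
      sumᴺ a _ + sumᴺ b _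
        ≡⟨ cong₂ _+_ (sumᴺ-zero a (λ {k} k<a → y≡0⇒x*y≡0 (L i k) (⊕-topRight X′ a Y′ j k<a)))
                     (sumᴺ-zero b (λ {k} _ → x≡0⇒x*y≡0 _ (⊕-topRight X a Y k i<a))) ⟩
      0ℤ                    ≡⟨ sym (⊕-topRight (mulᴺ a X X′) a (mulᴺ b Y Y′) j i<a) ⟩
      _                     ∎
    split (beyond i) (inside j<a) = begin
      sumᴺ a _ + sumᴺ b _
        ≡⟨ cong₂ _+_ (sumᴺ-zero a (λ k<a → x≡0⇒x*y≡0 _ (⊕-bottomLeft X a Y i k<a)))
                     (sumᴺ-zero b (λ {k} _ →
                       y≡0⇒x*y≡0 (L (a ℕ.+ i) (a ℕ.+ k)) (⊕-bottomLeft X′ a Y′ k j<a))) ⟩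
      0ℤ                    ≡⟨ sym (⊕-bottomLeft (mulᴺ a X X′) a (mulᴺ b Y Y′) i j<a) ⟩
      _                     ∎
    split (beyond i) (beyond j) = begin
      sumᴺ a _ + sumᴺ b _
        ≡⟨ cong₂ _+_ (sumᴺ-zero a (λ k<a → x≡0⇒x*y≡0 _ (⊕-bottomLeft X a Y i k<a)))
                     (sumᴺ-cong b (λ {k} _ →
                       cong₂ _*_ (⊕-bottomRight X a Y i k) (⊕-bottomRight X′ a Y′ k j))) ⟩
      0ℤ + mulᴺ b Y Y′ i j  ≡⟨ ℤ.+-identityˡ _ ⟩
      mulᴺ b Y Y′ i j       ≡⟨ sym (⊕-bottomRight (mulᴺ a X X′) a (mulᴺ b Y Y′) i j) ⟩
      _                     ∎

  punchInᴺ-< : ∀ {j a k} → j ℕ.≤ a → k < a → punchInᴺ j k < suc a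
  punchInᴺ-< {zero}              _         k<a       = s<s k<a
  punchInᴺ-< {suc j} {suc a} {zero}  _         _         = z<s
  punchInᴺ-< {suc j} {suc a} {suc k} (s≤s j≤a) (s<s k<a) = s<s (punchInᴺ-< j≤a k<a)

  punchInᴺ-beyond : ∀ {j a} k → j ℕ.≤ a → punchInᴺ j (a ℕ.+ k) ≡ suc a ℕ.+ k
  punchInᴺ-beyond {zero}         k _         = refl
  punchInᴺ-beyond {suc j} {suc a} k (s≤s j≤a) = cong suc (punchInᴺ-beyond k j≤a)

  minorᴺ-⊕ : ∀ {j a} X Y → j ℕ.≤ a → ∀ i k →
             minorᴺ j (X ⊕[ suc a ] Y) i k ≡ (minorᴺ j X ⊕[ a ] Y) i k
  minorᴺ-⊕ {j} {a} X Y j≤a i k with position a i | position a k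
  ... | inside i<a | inside k<a = trans (⊕-topLeft X (suc a) Y (s<s i<a) (punchInᴺ-< j≤a k<a))
                                        (sym (⊕-topLeft (minorᴺ j X) a Y i<a k<a))
  ... | inside i<a | beyond k   = trans (cong ((X ⊕[ suc a ] Y) (suc i)) (punchInᴺ-beyond k j≤a))
                                    (trans (⊕-topRight X (suc a) Y k (s<s i<a))
                                           (sym (⊕-topRight (minorᴺ j X) a Y k i<a)))
  ... | beyond i   | inside k<a = trans (⊕-bottomLeft X (suc a) Y i (punchInᴺ-< j≤a k<a))
                                        (sym (⊕-bottomLeft (minorᴺ j X) a Y i k<a))
  ... | beyond i   | beyond k   = trans (cong ((X ⊕[ suc a ] Y) (suc a ℕ.+ i)) (punchInᴺ-beyond k j≤a))
                                        (trans (⊕-bottomRight X (suc a) Y i k)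
                                               (sym (⊕-bottomRight (minorᴺ j X) a Y i k)))

  detᴺ-⊕ : ∀ a b X Y → detᴺ (a ℕ.+ b) (X ⊕[ a ] Y) ≡ detᴺ a X * detᴺ b Y
  detᴺ-⊕ zero    b X Y = sym (ℤ.*-identityˡ (detᴺ b Y))
  detᴺ-⊕ (suc a) b X Y = begin
    sumᴺ (suc a ℕ.+ b) term
      ≡⟨ sumᴺ-split (suc a) b term ⟩
    sumᴺ (suc a) term + sumᴺ b (λ k → term (suc a ℕ.+ k))
      ≡⟨ cong₂ _+_ (sumᴺ-cong (suc a) expand) (sumᴺ-zero b (λ {k} _ → outside k)) ⟩
    sumᴺ (suc a) (λ j → cofactor j * detᴺ b Y) + 0ℤ
      ≡⟨ ℤ.+-identityʳ _ ⟩
    sumᴺ (suc a) (λ j → cofactor j * detᴺ b Y)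
      ≡⟨ sumᴺ-*ʳ (suc a) cofactor (detᴺ b Y) ⟩
    detᴺ (suc a) X * detᴺ b Y
      ∎
    where
    Z = X ⊕[ suc a ] Y
    term : ℕ → ℤ
    term j = sign j * (Z 0 j * detᴺ (a ℕ.+ b) (minorᴺ j Z))
    cofactor : ℕ → ℤ
    cofactor j = sign j * (X 0 j * detᴺ a (minorᴺ j X))
    expand : ∀ {j} → j < suc a → term j ≡ cofactor j * detᴺ b Y
    expand {j} (s≤s j≤a) = begin
      sign j * (Z 0 j * detᴺ (a ℕ.+ b) (minorᴺ j Z))
        ≡⟨ cong₂ (λ x y → sign j * (x * y)) (⊕-topLeft X (suc a) Y z<s (s≤s j≤a))
                 (trans (detᴺ-cong (a ℕ.+ b) (minorᴺ-⊕ X Y j≤a)) (detᴺ-⊕ a b (minorᴺ j X) Y)) ⟩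
      sign j * (X 0 j * (detᴺ a (minorᴺ j X) * detᴺ b Y))
        ≡⟨ cong (sign j *_) (sym (ℤ.*-assoc (X 0 j) _ _)) ⟩
      sign j * (X 0 j * detᴺ a (minorᴺ j X) * detᴺ b Y)
        ≡⟨ sym (ℤ.*-assoc (sign j) _ _) ⟩
      cofactor j * detᴺ b Y
        ∎
    outside : ∀ k → term (suc a ℕ.+ k) ≡ 0ℤ
    outside k = y≡0⇒x*y≡0 (sign (suc a ℕ.+ k)) (x≡0⇒x*y≡0 _ (⊕-topRight X (suc a) Y k z<s))

  transformᴺ : ℕ → Matᴺ → Matᴺ → Matᴺ
  transformᴺ n P S = mulᴺ n (transposeᴺ P) (mulᴺ n S P)

  transformᴺ-idᴺ : ∀ n S {i j} → i < n → j < n → transformᴺ n idᴺ S i j ≡ S i j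
  transformᴺ-idᴺ n S {i} {j} i<n j<n = begin
    mulᴺ n (transposeᴺ idᴺ) (mulᴺ n S idᴺ) i j
      ≡⟨ mulᴺ-cong n {Y = mulᴺ n S idᴺ} transposeᴺ-idᴺ (λ _ _ → refl) i j ⟩
    mulᴺ n idᴺ (mulᴺ n S idᴺ) i j
      ≡⟨ mulᴺ-identityˡ n (mulᴺ n S idᴺ) i<n ⟩
    mulᴺ n S idᴺ i j
      ≡⟨ mulᴺ-identityʳ n S j<n ⟩
    S i j
      ∎

  transformᴺ-⊕ : ∀ a b P P′ S S′ i j →
    transformᴺ (a ℕ.+ b) (P ⊕[ a ] P′) (S ⊕[ a ] S′) i j
      ≡ (transformᴺ a P S ⊕[ a ] transformᴺ b P′ S′) i j
  transformᴺ-⊕ a b P P′ S S′ i j = begin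
    mulᴺ (a ℕ.+ b) (transposeᴺ (P ⊕[ a ] P′)) (mulᴺ (a ℕ.+ b) (S ⊕[ a ] S′) (P ⊕[ a ] P′)) i j
      ≡⟨ mulᴺ-cong (a ℕ.+ b) (transposeᴺ-⊕ a P P′) (mulᴺ-⊕ a b S S′ P P′) i j ⟩
    mulᴺ (a ℕ.+ b) (transposeᴺ P ⊕[ a ] transposeᴺ P′) (mulᴺ a S P ⊕[ a ] mulᴺ b S′ P′) i j
      ≡⟨ mulᴺ-⊕ a b (transposeᴺ P) (transposeᴺ P′) (mulᴺ a S P) (mulᴺ b S′ P′) i j ⟩
    (transformᴺ a P S ⊕[ a ] transformᴺ b P′ S′) i j
      ∎

  sumFin-toℕ : ∀ {n} {g : Fin n → ℤ} {f : ℕ → ℤ} → (∀ i → g i ≡ f (toℕ i)) → sumFin g ≡ sumᴺ n f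
  sumFin-toℕ {zero}  g≗f = refl
  sumFin-toℕ {suc n} g≗f = cong₂ _+_ (g≗f fzero) (sumFin-toℕ (λ i → g≗f (fsuc i)))

  toℕ-punchIn : ∀ {n} (j : Fin (suc n)) (k : Fin n) → toℕ (punchIn j k) ≡ punchInᴺ (toℕ j) (toℕ k)
  toℕ-punchIn fzero    k        = refl
  toℕ-punchIn (fsuc j) fzero    = refl
  toℕ-punchIn (fsuc j) (fsuc k) = cong suc (toℕ-punchIn j k)

  det-toℕ : ∀ {n} (M : Mat n ℤ) (X : Matᴺ) →
            (∀ i j → M i j ≡ X (toℕ i) (toℕ j)) → det M ≡ detᴺ n X
  det-toℕ {zero}  M X M≗X = refl
  det-toℕ {suc n} M X M≗X =
    sumFin-toℕ {f = λ j → sign j * (X 0 j * detᴺ n (minorᴺ j X))} (λ j →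
      cong₂ (λ x y → sign (toℕ j) * (x * y)) (M≗X fzero j)
            (det-toℕ (λ i k → M (fsuc i) (punchIn j k)) (minorᴺ (toℕ j) X) (λ i k →
               trans (M≗X (fsuc i) (punchIn j k)) (cong (X (suc (toℕ i))) (toℕ-punchIn j k)))))

open Matrix

record Congruent (d : ℕ) .{{_ : ℕ.NonZero d}} (n : ℕ) (S T : Matᴺ) : Set where
  field
    basis      : Matᴺ
    det-basis  : detᴺ n basis ≡ 1ℤ
    transforms : ∀ {i j} → i < n → j < n → transformᴺ n basis S i j %ℕ d ≡ T i j %ℕ d

module _ {d : ℕ} .{{_ : ℕ.NonZero d}} where

  Congruent-refl : ∀ {n S} → Congruent d n S S
  Congruent-refl {n} {S} = record
    { basis      = idᴺ
    ; det-basis  = detᴺ-idᴺ n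
    ; transforms = λ i<n j<n → cong (_%ℕ d) (transformᴺ-idᴺ n S i<n j<n)
    }

  Congruent-⊕ : ∀ {a b S T S′ T′} → Congruent d a S T → Congruent d b S′ T′ →
                Congruent d (a ℕ.+ b) (S ⊕[ a ] S′) (T ⊕[ a ] T′)
  Congruent-⊕ {a} {b} {S} {T} {S′} {T′} S≅T S′≅T′ = record
    { basis      = P ⊕[ a ] P′
    ; det-basis  = trans (detᴺ-⊕ a b P P′) (cong₂ ℤ._*_ (det-basis S≅T) (det-basis S′≅T′))
    ; transforms = λ {i} {j} i<n j<n →
        trans (cong (_%ℕ d) (transformᴺ-⊕ a b P P′ S S′ i j))
              (⊕-pointwise (λ x y → x %ℕ d ≡ y %ℕ d) refl
                 {X = transformᴺ a P S} {T} {transformᴺ b P′ S′} {T′}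
                 (transforms S≅T) (transforms S′≅T′) i<n j<n)
    }
    where
    open Congruent
    P  = basis S≅T
    P′ = basis S′≅T′

  Congruent-resp : ∀ {n S S′ T T′} → (∀ i j → S i j ≡ S′ i j) → (∀ i j → T i j ≡ T′ i j) →
                   Congruent d n S T → Congruent d n S′ T′
  Congruent-resp {n} S≗S′ T≗T′ S≅T = record
    { basis      = basis
    ; det-basis  = det-basis
    ; transforms = λ {i} {j} i<n j<n →
        trans (cong (_%ℕ d) (sumᴺ-cong n (λ {k} _ → cong (basis k i ℤ.*_)
                (sumᴺ-cong n (λ {l} _ → cong (ℤ._* basis l j) (sym (S≗S′ k l)))))))
              (trans (transforms i<n j<n) (cong (_%ℕ d) (T≗T′ i j)))
    }
    where open Congruent S≅T

patternᴺ : List Block → Matᴺ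
patternᴺ bs i j = + bdEntry bs i j

patternᴺ-∷ : ∀ b bs i j →
             patternᴺ (b ∷ bs) i j ≡ (patternᴺ (b ∷ []) ⊕[ bsize b ] patternᴺ bs) i j
patternᴺ-∷ b bs i j with i <ᵇ bsize b | j <ᵇ bsize b
... | true  | true  = refl
... | true  | false = refl
... | false | true  = refl
... | false | false = refl

totalSize-++ : ∀ bs cs → totalSize (bs ++ cs) ≡ totalSize bs ℕ.+ totalSize cs
totalSize-++ []       cs = refl
totalSize-++ (b ∷ bs) cs =
  trans (cong (bsize b ℕ.+_) (totalSize-++ bs cs)) (sym (ℕ.+-assoc (bsize b) _ _))

patternᴺ-++ : ∀ bs cs i j →
              patternᴺ (bs ++ cs) i j ≡ (patternᴺ bs ⊕[ totalSize bs ] patternᴺ cs) i j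
patternᴺ-++ []       cs i j = refl
patternᴺ-++ (b ∷ bs) cs i j = begin
  patternᴺ (b ∷ bs ++ cs) i j
    ≡⟨ patternᴺ-∷ b (bs ++ cs) i j ⟩
  (patternᴺ (b ∷ []) ⊕[ k ] patternᴺ (bs ++ cs)) i j
    ≡⟨ ⊕-congʳ k (patternᴺ (b ∷ [])) (patternᴺ-++ bs cs) i j ⟩
  (patternᴺ (b ∷ []) ⊕[ k ] (patternᴺ bs ⊕[ l ] patternᴺ cs)) i j
    ≡⟨ ⊕-assoc k l (patternᴺ (b ∷ [])) (patternᴺ bs) (patternᴺ cs) i j ⟩
  ((patternᴺ (b ∷ []) ⊕[ k ] patternᴺ bs) ⊕[ k ℕ.+ l ] patternᴺ cs) i j
    ≡⟨ ⊕-congˡ (k ℕ.+ l) (patternᴺ cs) (λ i j → sym (patternᴺ-∷ b bs i j)) i j ⟩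
  (patternᴺ (b ∷ bs) ⊕[ k ℕ.+ l ] patternᴺ cs) i j
    ∎
  where
  open ≡-Reasoning
  k = bsize b
  l = totalSize bs

bentry-≤2 : ∀ b i j → bentry b i j ℕ.≤ 2
bentry-≤2 H  zero    zero    = ℕ.≤-refl
bentry-≤2 H  zero    (suc _) = s≤s z≤n
bentry-≤2 H  (suc _) zero    = s≤s z≤n
bentry-≤2 H  (suc _) (suc _) = ℕ.≤-refl
bentry-≤2 U  zero    zero    = z≤n
bentry-≤2 U  zero    (suc _) = s≤s z≤n
bentry-≤2 U  (suc _) zero    = s≤s z≤n
bentry-≤2 U  (suc _) (suc _) = z≤n
bentry-≤2 V  zero    zero    = z≤n
bentry-≤2 V  zero    (suc _) = ℕ.≤-refl
bentry-≤2 V  (suc _) zero    = ℕ.≤-refl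
bentry-≤2 V  (suc _) (suc _) = z≤n
bentry-≤2 D2 _       _       = ℕ.≤-refl
bentry-≤2 D0 _       _       = z≤n

bdEntry-≤2 : ∀ bs i j → bdEntry bs i j ℕ.≤ 2
bdEntry-≤2 []       i j = z≤n
bdEntry-≤2 (b ∷ bs) i j with i <ᵇ bsize b | j <ᵇ bsize b
... | true  | true  = bentry-≤2 b i j
... | true  | false = z≤n
... | false | true  = z≤n
... | false | false = bdEntry-≤2 bs (i ∸ bsize b) (j ∸ bsize b)

infix 4 _≅₄_

record _≅₄_ (bs cs : List Block) : Set where
  field
    totalSize-≡ : totalSize bs ≡ totalSize cs
    congruent   : Congruent 4 (totalSize bs) (patternᴺ bs) (patternᴺ cs)

open _≅₄_

≅₄-refl : ∀ {bs} → bs ≅₄ bs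
≅₄-refl = record { totalSize-≡ = refl ; congruent = Congruent-refl }

≅₄-++ : ∀ {bs cs bs′ cs′} → bs ≅₄ cs → bs′ ≅₄ cs′ → bs ++ bs′ ≅₄ cs ++ cs′
≅₄-++ {bs} {cs} {bs′} {cs′} bs≅cs bs′≅cs′ = record
  { totalSize-≡ = begin
      totalSize (bs ++ bs′)                ≡⟨ totalSize-++ bs bs′ ⟩
      totalSize bs ℕ.+ totalSize bs′       ≡⟨ cong₂ ℕ._+_ (totalSize-≡ bs≅cs) (totalSize-≡ bs′≅cs′) ⟩
      totalSize cs ℕ.+ totalSize cs′       ≡⟨ totalSize-++ cs cs′ ⟨
      totalSize (cs ++ cs′)                ∎
  ; congruent = subst (λ n → Congruent 4 n (patternᴺ (bs ++ bs′)) (patternᴺ (cs ++ cs′)))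
      (sym (totalSize-++ bs bs′))
      (Congruent-resp (λ i j → sym (patternᴺ-++ bs bs′ i j))
        (λ i j → trans (cong (λ a → (patternᴺ cs ⊕[ a ] patternᴺ cs′) i j) (totalSize-≡ bs≅cs))
                       (sym (patternᴺ-++ cs cs′ i j)))
        (Congruent-⊕ (congruent bs≅cs) (congruent bs′≅cs′)))
  }
  where open ≡-Reasoning

fromRows : List (List ℤ) → Matᴺ
fromRows rows i j = fromMaybe 0ℤ (head (drop j (fromMaybe [] (head (drop i rows)))))

-- Qᵀ (H ⊕ H) Q = (8 5 4 4; 5 8 4 4; 4 4 4 1; 4 4 1 4) ≡ U ⊕ U modulo 4, and det Q = 1.
hyperbolicBasis : Matᴺ
hyperbolicBasis = fromRows
  ( (-1ℤ ∷ -1ℤ ∷ 0ℤ  ∷ -1ℤ ∷ [])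
  ∷ (0ℤ  ∷ 0ℤ  ∷ -1ℤ ∷ 1ℤ  ∷ [])
  ∷ (1ℤ  ∷ -1ℤ ∷ 0ℤ  ∷ 0ℤ  ∷ [])
  ∷ (1ℤ  ∷ + 2 ∷ 1ℤ  ∷ 1ℤ  ∷ [])
  ∷ [])

HH≅₄UU : H ∷ H ∷ [] ≅₄ U ∷ U ∷ []
HH≅₄UU = record
  { totalSize-≡ = refl
  ; congruent   = record
    { basis      = hyperbolicBasis
    ; det-basis  = refl
    ; transforms = λ i<4 j<4 → entrywise i<4 j<4
    }
  }
  where
  transformed target : ℕ → ℕ → ℕ
  transformed i j = transformᴺ 4 hyperbolicBasis (patternᴺ (H ∷ H ∷ [])) i j %ℕ 4
  target      i j = patternᴺ (U ∷ U ∷ []) i j %ℕ 4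
  entrywise : ∀ {i} → i < 4 → ∀ {j} → j < 4 → transformed i j ≡ target i j
  entrywise = from-yes (ℕ.allUpTo? (λ i → ℕ.allUpTo? (λ j → transformed i j ℕ.≟ target i j) 4) 4)

change-of-basis : ∀ {bs cs n} (A : Mat n ℤ) → bs ≅₄ cs → totalSize bs ≡ n →
  (∀ i j → mod4 A i j ≡ blockDiag n bs i j) →
  Σ (Mat n ℤ) λ P → Unimodular P × (∀ i j → mod4 (transpose P · (A · P)) i j ≡ blockDiag n cs i j)
change-of-basis {bs} {cs} A bs≅cs refl A≡bs = P , inj₁ det-P≡1 , reduce
  where
  open import Data.Integer using (_*_)
  open Congruent (congruent bs≅cs)
  open ≡-Reasoning
  n = totalSize bs
  P : Mat n ℤ
  P i j = basis (toℕ i) (toℕ j)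
  det-P≡1 : det P ≡ 1ℤ
  det-P≡1 = trans (det-toℕ P basis (λ _ _ → refl)) det-basis
  reduce : ∀ i j → mod4 (transpose P · (A · P)) i j ≡ blockDiag n cs i j
  reduce i j = begin
    sumFin (λ a → P a i * sumFin (λ b → A a b * P b j)) %ℕ 4
      ≡⟨ mod⇒%ℕ≡ (mod-sumFin-cong λ a → mod-*-cong (mod-refl {x = P a i}) (mod-sumFin-cong λ b →
                    mod-*-cong (x≡x%ℕd-mod (A a b)) (mod-refl {x = P b j}))) ⟩
    sumFin (λ a → P a i * sumFin (λ b → + (A a b %ℕ 4) * P b j)) %ℕ 4
      ≡⟨ cong (_%ℕ 4) (sumFin-toℕ λ a → cong (P a i *_) (sumFin-toℕ λ b →
                    cong (λ x → + x * P b j) (A≡bs a b))) ⟩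
    transformᴺ n basis (patternᴺ bs) (toℕ i) (toℕ j) %ℕ 4
      ≡⟨ transforms (toℕ<n i) (toℕ<n j) ⟩
    bdEntry cs (toℕ i) (toℕ j) ℕ.% 4
      ≡⟨ m<n⇒m%n≡m (s≤s (ℕ.m≤n⇒m≤1+n (bdEntry-≤2 cs (toℕ i) (toℕ j)))) ⟩
    bdEntry cs (toℕ i) (toℕ j)
      ∎

open import Data.Nat using (_+_; _*_; _≤_)
open import Data.Nat.DivMod using (_%_; _/_)

replicate-+ : ∀ {A : Set} m n (x : A) → replicate (m + n) x ≡ replicate m x ++ replicate n x
replicate-+ zero    n x = refl
replicate-+ (suc m) n x = cong (x ∷_) (replicate-+ m n x)

evenH≅₄evenU : ∀ q → replicate (q * 2) H ≅₄ replicate (q * 2) U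
evenH≅₄evenU zero    = ≅₄-refl
evenH≅₄evenU (suc q) = ≅₄-++ HH≅₄UU (evenH≅₄evenU q)

nfBlocks-trade : ∀ r q s t p m → nfBlocks (r + q * 2) s t p m ≅₄ nfBlocks r (q * 2 + s) t p m
nfBlocks-trade r q s t p m = subst₂ _≅₄_ (sym source) (sym target)
  (≅₄-++ (≅₄-refl {replicate r H}) (≅₄-++ (evenH≅₄evenU q) (≅₄-refl {replicate s U ++ rest})))
  where
  rest = replicate t V ++ replicate p D2 ++ replicate m D0
  source : nfBlocks (r + q * 2) s t p m ≡ replicate r H ++ replicate (q * 2) H ++ replicate s U ++ rest
  source = trans (cong (_++ replicate s U ++ rest) (replicate-+ r (q * 2) H))
                 (List.++-assoc (replicate r H) _ _)
  target : nfBlocks r (q * 2 + s) t p m ≡ replicate r H ++ replicate (q * 2) U ++ replicate s U ++ rest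
  target = cong (replicate r H ++_) (trans (cong (_++ rest) (replicate-+ (q * 2) s U))
                                           (List.++-assoc (replicate (q * 2) U) _ _))

nfBlocks-trade-pair : ∀ r s t p m → nfBlocks (2 + r) s t p m ≅₄ nfBlocks r (2 + s) t p m
nfBlocks-trade-pair r s t p m = subst (_≅₄ nfBlocks r (2 + s) t p m)
  (cong (λ k → nfBlocks k s t p m) (ℕ.+-comm r 2))
  (nfBlocks-trade r 1 s t p m)

nfBlocks-trade-to-parity : ∀ k s t p m → nfBlocks k s t p m ≅₄ nfBlocks (k % 2) (k / 2 * 2 + s) t p m
nfBlocks-trade-to-parity k s t p m = subst (_≅₄ nfBlocks (k % 2) (k / 2 * 2 + s) t p m)
  (cong (λ k → nfBlocks k s t p m) (sym (m≡m%n+[m/n]*n k 2)))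
  (nfBlocks-trade (k % 2) (k / 2) s t p m)

lemma2p4 : (n : ℕ) (A : Mat n ℤ) → Symmetric A →
    (r s t p m : ℕ) → totalSize (nfBlocks (2 + r) s t p m) ≡ n →
    (∀ i j → mod4 A i j ≡ blockDiag n (nfBlocks (2 + r) s t p m) i j) →
    (Σ (Mat n ℤ) λ P → Unimodular P ×
       (∀ i j → mod4 (transpose P · (A · P)) i j ≡ blockDiag n (nfBlocks r (2 + s) t p m) i j))
    × (Σ ℕ λ r′ → Σ ℕ λ s′ → Σ ℕ λ t′ → Σ ℕ λ p′ → Σ ℕ λ m′ →
       r′ ≤ 1 × totalSize (nfBlocks r′ s′ t′ p′ m′) ≡ n ×
       (Σ (Mat n ℤ) λ P → Unimodular P ×
          (∀ i j → mod4 (transpose P · (A · P)) i j ≡ blockDiag n (nfBlocks r′ s′ t′ p′ m′) i j)))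
lemma2p4 n A _ r s t p m size A≡nf =
    change-of-basis A (nfBlocks-trade-pair r s t p m) size A≡nf
  , ( k % 2 , k / 2 * 2 + s , t , p , m
    , ℕ.s≤s⁻¹ (m%n<n k 2)
    , trans (sym (totalSize-≡ parity)) size
    , change-of-basis A parity size A≡nf )
  where
  k = 2 + r
  parity = nfBlocks-trade-to-parity k s t p m
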